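{- Let $\Sigma$, $\Gamma$, a data stream $\mathbf D$, $t\geq1$ and a program $\mathcal P$ be as in the context. Let $(\mathbf I,\mathbf J)$ be a 3-valued stream and let $\mathbf K$ be a stream with $\mathbf I\subseteq\mathbf K\subseteq\mathbf J$. Then $\Phi_{\mathcal P^{\mathbf K,t},\mathbf D,t}(\mathbf I,\mathbf J)=\Phi_{\mathcal P,\mathbf D,t}(\mathbf I,\mathbf J)$.
   Context: $\Sigma$ is a finite nonempty set of propositional atoms containing a special symbol $\top$. Formulas: $\alpha::=a\mid\neg\alpha\mid\alpha\land\alpha\mid\alpha\lor\alpha\mid\alpha\rightarrow\alpha\mid\Diamond\alpha\mid\Box\alpha\mid @_{t'}\alpha\mid\boxplus_{[\ell,r]}\alpha$ with $a\in\Sigma$, integer $t'\geq1$, $\ell,r\in\mathbb N\cup\{\infty\}$, $\ell\leq r$. Normal: none of $\neg,\lor,\rightarrow,\Diamond$. A stream is $\mathbf I=I_1I_2\ldots$ with $I_s\subseteq\Sigma$; $\subseteq$, $\cup$ pointwise; $\{a\}_s$ has $\{a\}$ at $s$, $\emptyset$ elsewhere. $\mathrm{supp}\,\mathbf I$: tightest interval containing $\{s\mid I_s\neq\emptyset\}$, empty for the all-empty stream. $\mathbf I[\ell,r;s]$ agrees with $\mathbf I$ at $u$ with $s-\ell\leq u\leq s+r$, empty elsewhere. Fix $\Gamma\subseteq\Sigma$. Entailment: $\mathbf I,s\models_\Gamma\top$; for $a\neq\top$, $\mathbf I,s\models_\Gamma a$ iff $a\in I_s\cup\Gamma$; $\neg,\land,\lor,\rightarrow$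 classically; $\Diamond\alpha$/$\Box\alpha$ at $s$ iff $\alpha$ at some/every $s'\in\mathrm{supp}\,\mathbf I$; $@_{s'}\alpha$ at $s$ iff $\alpha$ at $s'$; $\mathbf I,s\models_\Gamma\boxplus_{[\ell,r]}\alpha$ iff $\mathbf I[\ell,r;s],s\models_\Gamma\alpha$. Partial model operator: $\mathrm M_{\mathbf I,s}(a)=\{a\}_s$ if $a\notin\Gamma$, $\emptyset$ if $a\in\Gamma$; $\mathrm M_{\mathbf I,s}(\alpha\land\beta)=\mathrm M_{\mathbf I,s}(\alpha)\cup\mathrm M_{\mathbf I,s}(\beta)$; $\mathrm M_{\mathbf I,s}(\Box\alpha)=\bigcup_{s'\in\mathrm{supp}\,\mathbf I}\mathrm M_{\mathbf I,s'}(\alpha)$; $\mathrm M_{\mathbf I,s}(@_{s'}\alpha)=\mathrm M_{\mathbf I,s'}(\alpha)$; $\mathrm M_{\mathbf I,s}(\boxplus_{[\ell,r]}\alpha)=\mathrm M_{\mathbf I[\ell,r;s],s}(\alpha)$; for finite sets $A$, $\mathrm M_{\mathbf I,s}(A)=\bigcup_{\alpha\in A}\mathrm M_{\mathbf I,s}(\alpha)$ (empty union $=$ all-empty stream). $\mathrm{MM}_{\mathbf I,s}(X)=\mathrm M_{\mathrm M_{\mathbf I,s}(X),s}(X)$. A program $\mathcal P$ is a finite set of rules $\rho$: $\alpha\leftarrow\beta_1,\ldots,\beta_j,{\sim}\beta_{j+1},\ldots,{\sim}\beta_k$ ($k\geq j\geq1$), $\alpha$ a normal formula assumed $t$-consistent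 (satisfied at $t$ by some stream), $\beta_i$ formulas; $\mathrm H(\rho)=\alpha$, $\mathrm B(\rho)=\beta_1\land\cdots\land\beta_j\land\neg\beta_{j+1}\land\cdots\land\neg\beta_k$. The reduct is $\mathcal P^{\mathbf K,t}=\{\rho\in\mathcal P\mid\mathbf K,t\models_\Gamma\mathrm B(\rho)\}$. $\mathbf D$ is a fixed data stream. A 3-valued stream is a pair $(\mathbf I,\mathbf J)$ of streams with $\mathbf I\subseteq\mathbf J$; $(\mathbf I,\mathbf J),t\models_\Gamma\alpha$ iff $\mathbf K,t\models_\Gamma\alpha$ for all $\mathbf K$ with $\mathbf I\subseteq\mathbf K\subseteq\mathbf J$. For any finite set of rules $\mathcal Q$, $\Phi_{\mathcal Q,\mathbf D,t}(\mathbf I,\mathbf J)=\mathbf D\cup\mathrm{MM}_{\mathbf I,t}(\{\mathrm H(\rho)\mid\rho\in\mathcal Q,\ (\mathbf I,\mathbf J),t\models_\Gamma\mathrm B(\rho)\})$. -}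

module Defs where

open import Data.Nat using (ℕ; zero; suc; _+_; _≤_; _≤?_)
open import Data.Fin using (Fin)
import Data.Fin as F
open import Data.Fin.Subset using (Subset; _∈_; _∉_; _∪_; _⊆_) renaming (⊥ to ∅ˢ)
open import Data.List using (List; []; _∷_; _++_; map; foldl)
open import Data.Product using (Σ; ∃; ∃-syntax; _×_; _,_)
open import Data.Sum using (_⊎_)
open import Data.Empty using (⊥)
open import Data.Unit using (⊤)
open import Relation.Nullary using (¬_; Dec; yes; no)
open import Relation.Nullary.Decidable using (_×-dec_)
open import Relation.Binary.PropositionalEquality using (_≡_)
import Data.List.Membership.Propositional

-- Σ is a finite nonempty set of atoms containing ⊤: Σ = Fin (suc n),
-- with the special atom ⊤ being F.zero.

Atom : ℕ → Set
Atom n = Fin (suc n)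

data ℕ∞ : Set where
  fin : ℕ → ℕ∞
  ∞   : ℕ∞

data _≤∞_ : ℕ∞ → ℕ∞ → Set where
  fin≤fin : ∀ {l r} → l ≤ r → fin l ≤∞ fin r
  ≤∞∞     : ∀ {l} → l ≤∞ ∞

data Formula (n : ℕ) : Set where
  atom : Atom n → Formula n
  ¬f   : Formula n → Formula n
  _∧f_ : Formula n → Formula n → Formula n
  _∨f_ : Formula n → Formula n → Formula n
  _⇒f_ : Formula n → Formula n → Formula n
  ◇f   : Formula n → Formula n
  □f   : Formula n → Formula n
  at   : (t' : ℕ) → 1 ≤ t' → Formula n → Formula n
  ⊞    : (ℓ r : ℕ∞) → ℓ ≤∞ r → Formula n → Formula n

data Normal {n : ℕ} : Formula n → Set where
  atom : ∀ a → Normal (atom a)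
  _∧f_ : ∀ {α β} → Normal α → Normal β → Normal (α ∧f β)
  □f   : ∀ {α} → Normal α → Normal (□f α)
  at   : ∀ {t' p α} → Normal α → Normal (at t' p α)
  ⊞    : ∀ {ℓ r p α} → Normal α → Normal (⊞ ℓ r p α)

-- Streams. Time points are the positive naturals; position 0 of an
-- ℕ-indexed function is never consulted.

Stream : ℕ → Set
Stream n = ℕ → Subset (suc n)

-- "set-valued" streams (used for the output of the partial model
-- operator, which involves possibly infinite unions)
PStream : ℕ → Set₁
PStream n = ℕ → Atom n → Set

toP : ∀ {n} → Stream n → PStream n
toP I u a = a ∈ I u

_⊆ˢ_ : ∀ {n} → Stream n → Stream n → Set
I ⊆ˢ J = ∀ s → 1 ≤ s → I s ⊆ J s

LowOK : ℕ∞ → ℕ → ℕ → Set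
LowOK (fin l) s u = s ≤ u + l
LowOK ∞ s u = ⊤

HighOK : ℕ∞ → ℕ → ℕ → Set
HighOK (fin r) s u = u ≤ s + r
HighOK ∞ s u = ⊤

InWin : ℕ∞ → ℕ∞ → ℕ → ℕ → Set
InWin ℓ r s u = LowOK ℓ s u × HighOK r s u

lowOK? : ∀ ℓ s u → Dec (LowOK ℓ s u)
lowOK? (fin l) s u = s ≤? u + l
lowOK? ∞ s u = yes Data.Unit.tt

highOK? : ∀ r s u → Dec (HighOK r s u)
highOK? (fin r) s u = u ≤? s + r
highOK? ∞ s u = yes Data.Unit.tt

win : ∀ {n} → Stream n → ℕ∞ → ℕ∞ → ℕ → Stream n
win I ℓ r s u with lowOK? ℓ s u ×-dec highOK? r s u
... | yes _ = I u
... | no  _ = ∅ˢ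

winP : ∀ {n} → PStream n → ℕ∞ → ℕ∞ → ℕ → PStream n
winP S ℓ r s u a = InWin ℓ r s u × S u a

-- s ∈ supp S : s lies in the tightest interval (of positive time points)
-- containing all positions where S is nonempty
InSupp : ∀ {n} → PStream n → ℕ → Set
InSupp S s = (∃[ u ] (1 ≤ u × u ≤ s × ∃[ a ] S u a))
           × (∃[ v ] (s ≤ v × ∃[ a ] S v a))

-- Rules  α ← β₁,…,βⱼ, ∼βⱼ₊₁,…,∼βₖ   (j ≥ 1)

record Rule (n : ℕ) : Set where
  constructor rule
  field
    H      : Formula n
    posHd  : Formula n
    posTl  : List (Formula n)
    neg    : List (Formula n)

open Rule public

B : ∀ {n} → Rule n → Formula n
B ρ = foldl _∧f_ (posHd ρ) (posTl ρ ++ map ¬f (neg ρ))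

module Semantics {n : ℕ} (Γ : Subset (suc n)) where

  _,_⊨_ : Stream n → ℕ → Formula n → Set
  I , s ⊨ atom F.zero    = ⊤
  I , s ⊨ atom (F.suc k) = F.suc k ∈ (I s ∪ Γ)
  I , s ⊨ ¬f α    = ¬ (I , s ⊨ α)
  I , s ⊨ (α ∧f β) = (I , s ⊨ α) × (I , s ⊨ β)
  I , s ⊨ (α ∨f β) = (I , s ⊨ α) ⊎ (I , s ⊨ β)
  I , s ⊨ (α ⇒f β) = (I , s ⊨ α) → (I , s ⊨ β)
  I , s ⊨ ◇f α    = ∃[ s' ] (InSupp (toP I) s' × (I , s' ⊨ α))
  I , s ⊨ □f α    = ∀ s' → InSupp (toP I) s' → I , s' ⊨ α
  I , s ⊨ at t' _ α = I , t' ⊨ α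
  I , s ⊨ ⊞ ℓ r _ α = win I ℓ r s , s ⊨ α

  ⟨_,_⟩,_⊨₃_ : Stream n → Stream n → ℕ → Formula n → Set
  ⟨ I , J ⟩, t ⊨₃ α = ∀ K → I ⊆ˢ K → K ⊆ˢ J → K , t ⊨ α

  Consistent : ℕ → Formula n → Set
  Consistent t α = ∃[ K ] (K , t ⊨ α)

  -- partial model operator M_{S,s}(α) (only meaningful for normal α;
  -- non-normal formulas are mapped to the empty stream)
  M : PStream n → ℕ → Formula n → PStream n
  M S s (atom a) u b = u ≡ s × b ≡ a × a ∉ Γ
  M S s (α ∧f β) u b = M S s α u b ⊎ M S s β u b
  M S s (□f α)   u b = ∃[ s' ] (InSupp S s' × M S s' α u b)
  M S s (at t' _ α) u b = M S t' α u b
  M S s (⊞ ℓ r _ α) u b = M (winP S ℓ r s) s α u b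
  M S s (¬f α)   u b = ⊥
  M S s (α ∨f β) u b = ⊥
  M S s (α ⇒f β) u b = ⊥
  M S s (◇f α)   u b = ⊥

  MSet : PStream n → ℕ → (Formula n → Set) → PStream n
  MSet S s X u b = ∃[ α ] (X α × M S s α u b)

  MM : PStream n → ℕ → (Formula n → Set) → PStream n
  MM S s X = MSet (MSet S s X) s X

  RuleSet : Set₁
  RuleSet = Rule n → Set

  progSet : List (Rule n) → RuleSet
  progSet P ρ = Data.List.Membership.Propositional._∈_ ρ P

  reduct : RuleSet → Stream n → ℕ → RuleSet
  reduct P K t ρ = P ρ × (K , t ⊨ B ρ)

  Φ : RuleSet → Stream n → ℕ → Stream n → Stream n → PStream n
  Φ Q D t I J u a =
    (a ∈ D u) ⊎ MM (toP I) t (λ α → ∃[ ρ ] (Q ρ × (⟨ I , J ⟩, t ⊨₃ B ρ) × H ρ ≡ α)) u a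

-- The only rules that contribute to Φ_{Q,D,t}(I,J) are those of Q whose body is
-- 3-valued true at (I,J), and Φ is monotone in that set of rules. A body that is
-- 3-valued true holds in every K between I and J, so such a rule of P survives in
-- the reduct P^{K,t}; conversely the reduct is a subset of P. Hence both programs
-- activate the same rules.
module Submission where

open import Defs
open import Data.Nat using (ℕ; suc; _≤_)
open import Data.Fin.Subset using (Subset)
open import Data.List using (List)
open import Data.List.Relation.Unary.All using (All)
open import Data.Product using (_×_; _,_; ∃-syntax)
open import Data.Sum using (inj₁; inj₂; map₂)
open import Function.Bundles using (_⇔_; mk⇔)
open import Relation.Binary.PropositionalEquality using (_≡_)
open import Relation.Unary using (Pred; _⊆_)

_⊆ᴾ_ : ∀ {n} → PStream n → PStream n → Set
S ⊆ᴾ S' = ∀ {u b} → S u b → S' u b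

InSupp-mono : ∀ {n} {S S' : PStream n} → S ⊆ᴾ S' → ∀ {s} → InSupp S s → InSupp S' s
InSupp-mono S⊆S' ((u , 1≤u , u≤s , a , Sua) , (v , s≤v , b , Svb)) =
  (u , 1≤u , u≤s , a , S⊆S' Sua) , (v , s≤v , b , S⊆S' Svb)

winP-mono : ∀ {n} {S S' : PStream n} → S ⊆ᴾ S' → ∀ ℓ r s → winP S ℓ r s ⊆ᴾ winP S' ℓ r s
winP-mono S⊆S' ℓ r s (inWin , Sub) = inWin , S⊆S' Sub

module _ {n : ℕ} (Γ : Subset (suc n)) where
  open Semantics Γ

  M-mono : ∀ {S S'} → S ⊆ᴾ S' → ∀ s α → M S s α ⊆ᴾ M S' s α
  M-mono S⊆S' s (atom a)    m             = m
  M-mono S⊆S' s (α ∧f β)    (inj₁ m)      = inj₁ (M-mono S⊆S' s α m)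
  M-mono S⊆S' s (α ∧f β)    (inj₂ m)      = inj₂ (M-mono S⊆S' s β m)
  M-mono S⊆S' s (□f α)      (s' , sp , m) = s' , InSupp-mono S⊆S' sp , M-mono S⊆S' s' α m
  M-mono S⊆S' s (at t' _ α) m             = M-mono S⊆S' t' α m
  M-mono {S} {S'} S⊆S' s (⊞ ℓ r _ α) m = M-mono (winP-mono {S = S} {S'} S⊆S' ℓ r s) s α m
  M-mono S⊆S' s (¬f α)      ()
  M-mono S⊆S' s (α ∨f β)    ()
  M-mono S⊆S' s (α ⇒f β)    ()
  M-mono S⊆S' s (◇f α)      ()

  MSet-mono : ∀ {S S'} {X Y : Pred (Formula n) _} → S ⊆ᴾ S' → X ⊆ Y → ∀ s →
              MSet S s X ⊆ᴾ MSet S' s Y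
  MSet-mono S⊆S' X⊆Y s (α , Xα , m) = α , X⊆Y Xα , M-mono S⊆S' s α m

  MM-mono : ∀ {X Y : Pred (Formula n) _} → X ⊆ Y → ∀ S s → MM S s X ⊆ᴾ MM S s Y
  MM-mono X⊆Y S s = MSet-mono (MSet-mono (λ m → m) X⊆Y s) X⊆Y s

  ActiveHeads : RuleSet → Stream n → Stream n → ℕ → Pred (Formula n) _
  ActiveHeads Q I J t α = ∃[ ρ ] (Q ρ × (⟨ I , J ⟩, t ⊨₃ B ρ) × H ρ ≡ α)

  ActiveHeads-mono : ∀ {Q Q' I J t} → (∀ {ρ} → Q ρ → ⟨ I , J ⟩, t ⊨₃ B ρ → Q' ρ) →
                     ActiveHeads Q I J t ⊆ ActiveHeads Q' I J t
  ActiveHeads-mono Q⊆Q' (ρ , Qρ , Bρ , Hρ≡α) = ρ , Q⊆Q' Qρ Bρ , Bρ , Hρ≡α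

  Φ-mono : ∀ {Q Q'} D t I J → (∀ {ρ} → Q ρ → ⟨ I , J ⟩, t ⊨₃ B ρ → Q' ρ) →
           Φ Q D t I J ⊆ᴾ Φ Q' D t I J
  Φ-mono D t I J Q⊆Q' = map₂ (MM-mono (ActiveHeads-mono Q⊆Q') (toP I) t)

  reduct-active : ∀ {P I J K t ρ} → I ⊆ˢ K → K ⊆ˢ J →
                  P ρ → ⟨ I , J ⟩, t ⊨₃ B ρ → reduct P K t ρ
  reduct-active {K = K} I⊆K K⊆J Pρ Bρ = Pρ , Bρ K I⊆K K⊆J

lemma1 : (n : ℕ) (Γ : Subset (suc n)) (D : Stream n) (t : ℕ) → 1 ≤ t →
         (P : List (Rule n)) →
         All (λ ρ → Normal (H ρ) × Semantics.Consistent Γ t (H ρ)) P →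
         (I J K : Stream n) → I ⊆ˢ J → I ⊆ˢ K → K ⊆ˢ J →
         ∀ u → 1 ≤ u → ∀ a →
         Semantics.Φ Γ (Semantics.reduct Γ (Semantics.progSet Γ P) K t) D t I J u a
           ⇔ Semantics.Φ Γ (Semantics.progSet Γ P) D t I J u a
lemma1 n Γ D t _ P _ I J K _ I⊆K K⊆J u _ a =
  mk⇔ (Φ-mono Γ D t I J (λ (Pρ , _) _ → Pρ))
      (Φ-mono Γ D t I J (reduct-active Γ {P = Semantics.progSet Γ P} I⊆K K⊆J))
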